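{- Let $A$ be a semi-ASM of order $n$, where $n$ is odd. Then $A$ has a semi-ASM extension $B$ all of whose entries are nonzero.
   Context: A semi-ASM of order $n$ is an $n\times n$ $(0,\pm1)$-matrix all of whose row and column sums equal $1$. If $A$ and $B$ are semi-ASMs of order $n$ and $B$ agrees with $A$ in every position where $A$ is nonzero, then $B$ is a semi-ASM extension of $A$. -}

module Defs where

open import Data.Nat using (ℕ; zero; suc)
open import Data.Fin using (Fin; zero; suc)
open import Data.Integer using (ℤ; +_; -[1+_]; _+_; 0ℤ; 1ℤ; -1ℤ)
open import Data.Sum using (_⊎_)
open import Data.Product using (_×_)
open import Relation.Binary.PropositionalEquality using (_≡_; _≢_)

-- n × n integer matrices, indexed by (row, column)
Matrix : ℕ → Set
Matrix n = Fin n → Fin n → ℤ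

sumℤ : ∀ {m} → (Fin m → ℤ) → ℤ
sumℤ {zero}  f = 0ℤ
sumℤ {suc m} f = f zero + sumℤ (λ i → f (suc i))

IsZeroPM1 : ℤ → Set
IsZeroPM1 x = (x ≡ 0ℤ ⊎ x ≡ 1ℤ) ⊎ x ≡ -1ℤ

record SemiASM {n : ℕ} (A : Matrix n) : Set where
  field
    entries : ∀ i j → IsZeroPM1 (A i j)
    rowSum  : ∀ i → sumℤ (λ j → A i j) ≡ 1ℤ
    colSum  : ∀ j → sumℤ (λ i → A i j) ≡ 1ℤ

record SemiASMExtension {n : ℕ} (A B : Matrix n) : Set where
  field
    semiASM-A : SemiASM A
    semiASM-B : SemiASM B
    agrees    : ∀ i j → A i j ≢ 0ℤ → B i j ≡ A i j

module Submission where

-- Let A be a semi-ASM of odd order n = 1 + 2k and let E be its zero pattern (E i j = 1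
-- when A i j = 0, else 0).  A line of A with p ones and q minus ones has p - q = 1, so it
-- has n - 1 - 2q = 2(k - q) zeros: every row and column sum of E is even.  If S is a
-- "balanced signing" of E, that is a matrix with S i j = ±1 where E i j = 1, S i j = 0
-- elsewhere, and all line sums 0, then B = A + S is the required extension: it agrees
-- with A off the zeros, is ±1 on them, and has the same line sums as A.
--
-- The heart of the file (module BalancedSignings) is that every rectangular 0/1 matrix E
-- with even line sums has a balanced signing, by induction on the number of ones.  Pick
-- ones at (r₀,c), (r₁,c), (r₁,d) with r₀ ≠ r₁ and c ≠ d (a second one in a line exists
-- by parity).  Clearing these three entries and toggling the entry at (r₀,d) gives a
-- 0/1 matrix E′ with even line sums and fewer ones; a balanced signing of E′ is turned
-- into one of E by adding ±(s, -s, -s, s) on the four corners (r₀,c), (r₀,d), (r₁,c),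
-- (r₁,d), with the sign s chosen to cancel, resp. create, the entry at (r₀,d).

open import Defs

module BalancedSignings where
  open import Data.Nat as ℕ using (ℕ; zero; suc)
  open import Data.Nat.Induction using (<-rec)
  import Data.Nat.Properties as ℕₚ
  open import Data.Integer as ℤ
    using (ℤ; +_; -[1+_]; _+_; _-_; -_; _*_; 0ℤ; 1ℤ; -1ℤ; _≤_; _<_; +≤+; -<+)
  import Data.Integer.Properties as ℤₚ
  open import Data.Integer.Tactic.RingSolver using (solve-∀)
  open import Data.Fin using (Fin; zero; suc; _≟_)
  import Data.Fin.Properties as Finₚ
  open import Data.Product using (∃; ∃₂; _×_; _,_; proj₁; proj₂)
  open import Data.Sum using (_⊎_; inj₁; inj₂)
  open import Data.Bool using (if_then_else_)
  open import Data.Empty using (⊥-elim)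
  open import Relation.Nullary using (Dec; yes; no; does; ¬_)
  open import Relation.Nullary.Decidable using (dec-true; dec-false; ¬?; _×-dec_)
  open import Relation.Binary.PropositionalEquality

  private variable
    m k : ℕ

  _² : ℤ → ℤ
  x ² = x * x

  square-zero : ∀ x → x ² ≡ 0ℤ → x ≡ 0ℤ
  square-zero (+ zero)    _ = refl
  square-zero (+ suc _)   ()
  square-zero -[1+ _ ]    ()

  square-one : ∀ x → x ² ≡ 1ℤ → x ≡ 1ℤ ⊎ x ≡ -1ℤ
  square-one (+ zero)        ()
  square-one (+ suc zero)    _ = inj₁ refl
  square-one (+ suc (suc _)) ()
  square-one -[1+ zero ]     _ = inj₂ refl
  square-one -[1+ suc _ ]    ()

  -- the sign of x, with the sign of 0 taken to be +1
  unit-sign : ℤ → ℤ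
  unit-sign (+ _)    = 1ℤ
  unit-sign -[1+ _ ] = -1ℤ

  unit-sign² : ∀ x → unit-sign x ² ≡ 1ℤ
  unit-sign² (+ _)    = refl
  unit-sign² -[1+ _ ] = refl

  neg-unit-sign² : ∀ x → (- unit-sign x) ² ≡ 1ℤ
  neg-unit-sign² (+ _)    = refl
  neg-unit-sign² -[1+ _ ] = refl

  interchange : ∀ a b c d → (a + b) + (c + d) ≡ (a + c) + (b + d)
  interchange = solve-∀

  𝟙 : {P : Set} → Dec P → ℤ
  𝟙 P? = if does P? then 1ℤ else 0ℤ

  𝟙-yes : {P : Set} (P? : Dec P) → P → 𝟙 P? ≡ 1ℤ
  𝟙-yes P? p rewrite dec-true P? p = refl

  𝟙-no : {P : Set} (P? : Dec P) → ¬ P → 𝟙 P? ≡ 0ℤ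
  𝟙-no P? ¬p rewrite dec-false P? ¬p = refl

  Bit : ℤ → Set
  Bit x = x ≡ 0ℤ ⊎ x ≡ 1ℤ

  𝟙-bit : {P : Set} (P? : Dec P) → Bit (𝟙 P?)
  𝟙-bit (yes _) = inj₂ refl
  𝟙-bit (no _)  = inj₁ refl

  Even : ℤ → Set
  Even x = ∃ λ h → x ≡ h + h

  even-+ : ∀ {x y} → Even x → Even y → Even (x + y)
  even-+ (h , refl) (h′ , refl) = h + h′ , interchange h h h′ h′

  even-*ˡ : ∀ z {x} → Even x → Even (z * x)
  even-*ˡ z (h , refl) = z * h , ℤₚ.*-distribˡ-+ z h h

  one-not-even : ¬ Even 1ℤ
  one-not-even (+ zero , ())
  one-not-even (+ suc h , 1≡h+h) =
    ℕₚ.0≢1+n (trans (ℕₚ.suc-injective (ℤₚ.+-injective 1≡h+h)) (ℕₚ.+-suc h h))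
  one-not-even (-[1+ _ ] , ())

  sum-cong : {f g : Fin m → ℤ} → (∀ i → f i ≡ g i) → sumℤ f ≡ sumℤ g
  sum-cong {zero}  f≡g = refl
  sum-cong {suc m} f≡g = cong₂ _+_ (f≡g zero) (sum-cong (λ i → f≡g (suc i)))

  sum-zero : sumℤ {m} (λ _ → 0ℤ) ≡ 0ℤ
  sum-zero {zero}  = refl
  sum-zero {suc m} = cong (_+_ 0ℤ) (sum-zero {m})

  sum-ones : sumℤ {m} (λ _ → 1ℤ) ≡ + m
  sum-ones {zero}  = refl
  sum-ones {suc m} = cong (_+_ 1ℤ) (sum-ones {m})

  sum-+ : (f g : Fin m → ℤ) → sumℤ (λ i → f i + g i) ≡ sumℤ f + sumℤ g
  sum-+ {zero}  f g = refl
  sum-+ {suc m} f g =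
    trans (cong (_+_ (f zero + g zero)) (sum-+ (λ i → f (suc i)) (λ i → g (suc i))))
          (interchange (f zero) (g zero) _ _)

  sum-*ˡ : ∀ x (f : Fin m → ℤ) → sumℤ (λ i → x * f i) ≡ x * sumℤ f
  sum-*ˡ {zero}  x f = sym (ℤₚ.*-zeroʳ x)
  sum-*ˡ {suc m} x f =
    trans (cong (_+_ (x * f zero)) (sum-*ˡ x (λ i → f (suc i))))
          (sym (ℤₚ.*-distribˡ-+ x (f zero) _))

  sum-single : (f : Fin m → ℤ) (a : Fin m) → (∀ i → i ≢ a → f i ≡ 0ℤ) → sumℤ f ≡ f a
  sum-single {suc m} f zero off =
    trans (cong (_+_ (f zero)) (trans (sum-cong (λ i → off (suc i) λ ())) (sum-zero {m})))
          (ℤₚ.+-identityʳ (f zero))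
  sum-single {suc m} f (suc a) off =
    trans (cong₂ _+_ (off zero λ ())
                     (sum-single (λ i → f (suc i)) a
                                 (λ i i≢a → off (suc i) (λ eq → i≢a (Finₚ.suc-injective eq)))))
          (ℤₚ.+-identityˡ (f (suc a)))

  sum-𝟙 : (a : Fin m) (x : ℤ) → sumℤ (λ i → 𝟙 (i ≟ a) * x) ≡ x
  sum-𝟙 a x =
    trans (sum-single _ a (λ i i≢a → cong (_* x) (𝟙-no (i ≟ a) i≢a)))
          (trans (cong (_* x) (𝟙-yes (a ≟ a) refl)) (ℤₚ.*-identityˡ x))

  sum-nonneg : (f : Fin m → ℤ) → (∀ i → 0ℤ ≤ f i) → 0ℤ ≤ sumℤ f
  sum-nonneg {zero}  f nonneg = +≤+ ℕ.z≤n
  sum-nonneg {suc m} f nonneg =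
    ℤₚ.+-mono-≤ (nonneg zero) (sum-nonneg (λ i → f (suc i)) (λ i → nonneg (suc i)))

  Mat : ℕ → ℕ → Set
  Mat m k = Fin m → Fin k → ℤ

  rowSum : Mat m k → Fin m → ℤ
  rowSum M i = sumℤ (M i)

  colSum : Mat m k → Fin k → ℤ
  colSum M j = sumℤ (λ i → M i j)

  total : Mat m k → ℤ
  total M = sumℤ (rowSum M)

  infixl 6 _⊕_
  _⊕_ : Mat m k → Mat m k → Mat m k
  (M ⊕ N) i j = M i j + N i j

  rowSum-⊕ : (M N : Mat m k) (i : Fin m) → rowSum (M ⊕ N) i ≡ rowSum M i + rowSum N i
  rowSum-⊕ M N i = sum-+ (M i) (N i)

  colSum-⊕ : (M N : Mat m k) (j : Fin k) → colSum (M ⊕ N) j ≡ colSum M j + colSum N j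
  colSum-⊕ M N j = sum-+ (λ i → M i j) (λ i → N i j)

  total-⊕ : (M N : Mat m k) → total (M ⊕ N) ≡ total M + total N
  total-⊕ M N = trans (sum-cong (rowSum-⊕ M N)) (sum-+ (rowSum M) (rowSum N))

  Binary : Mat m k → Set
  Binary M = ∀ i j → Bit (M i j)

  total-nonneg : {M : Mat m k} → Binary M → 0ℤ ≤ total M
  total-nonneg bits = sum-nonneg _ λ i → sum-nonneg _ λ j → bit-nonneg (bits i j)
    where
    bit-nonneg : ∀ {x} → Bit x → 0ℤ ≤ x
    bit-nonneg (inj₁ refl) = +≤+ ℕ.z≤n
    bit-nonneg (inj₂ refl) = +≤+ ℕ.z≤n

  EvenLines : Mat m k → Set
  EvenLines M = (∀ i → Even (rowSum M i)) × (∀ j → Even (colSum M j))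

  -- A balanced signing of a 0/1 matrix E: a matrix whose entries square to those of E
  -- (so ±1 on the ones of E and 0 elsewhere) and whose line sums all vanish.
  record BalancedSigning (E : Mat m k) : Set where
    field
      sign    : Mat m k
      squares : ∀ i j → sign i j ² ≡ E i j
      rows    : ∀ i → rowSum sign i ≡ 0ℤ
      cols    : ∀ j → colSum sign j ≡ 0ℤ

  zero-signing : {E : Mat m k} → (∀ i j → E i j ≡ 0ℤ) → BalancedSigning E
  zero-signing {m} {k} zeros = record
    { sign    = λ _ _ → 0ℤ
    ; squares = λ i j → sym (zeros i j)
    ; rows    = λ _ → sum-zero {k}
    ; cols    = λ _ → sum-zero {m}
    }

  find-one : (M : Mat m k) → Binary M → (∀ i j → M i j ≡ 0ℤ) ⊎ ∃₂ λ i j → M i j ≡ 1ℤ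
  find-one M bits with Finₚ.any? (λ i → Finₚ.any? (λ j → M i j ℤ.≟ 1ℤ))
  ... | yes (i , j , one) = inj₂ (i , j , one)
  ... | no none = inj₁ λ i j → zero-unless-one (bits i j) (λ one → none (i , j , one))
    where
    zero-unless-one : ∀ {x} → Bit x → x ≢ 1ℤ → x ≡ 0ℤ
    zero-unless-one (inj₁ x≡0) _   = x≡0
    zero-unless-one (inj₂ x≡1) x≢1 = ⊥-elim (x≢1 x≡1)

  another-one : (f : Fin m → ℤ) {p : Fin m} → (∀ i → Bit (f i)) → Even (sumℤ f) → f p ≡ 1ℤ →
                ∃ λ q → q ≢ p × f q ≡ 1ℤ
  another-one f {p} bits even fp≡1 with Finₚ.any? (λ q → ¬? (q ≟ p) ×-dec (f q ℤ.≟ 1ℤ))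
  ... | yes found = found
  ... | no none = ⊥-elim (one-not-even (subst Even (trans (sum-single f p zero-off-p) fp≡1) even))
    where
    zero-off-p : ∀ i → i ≢ p → f i ≡ 0ℤ
    zero-off-p i i≢p with bits i
    ... | inj₁ fi≡0 = fi≡0
    ... | inj₂ fi≡1 = ⊥-elim (none (i , i≢p , fi≡1))

  module Corners (a b : Fin m) (c d : Fin k) where

    line : Fin k → ℤ → ℤ → ℤ
    line j x y = 𝟙 (j ≟ c) * x + 𝟙 (j ≟ d) * y

    corners : (p q r u : ℤ) → Mat m k
    corners p q r u i j = 𝟙 (i ≟ a) * line j p q + 𝟙 (i ≟ b) * line j r u

    line-sum : ∀ x y → sumℤ (λ j → line j x y) ≡ x + y
    line-sum x y = trans (sum-+ (λ j → 𝟙 (j ≟ c) * x) (λ j → 𝟙 (j ≟ d) * y)) (cong₂ _+_ (sum-𝟙 c x) (sum-𝟙 d y))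

    rowSum-corners : ∀ p q r u i →
                     rowSum (corners p q r u) i ≡ 𝟙 (i ≟ a) * (p + q) + 𝟙 (i ≟ b) * (r + u)
    rowSum-corners p q r u i =
      trans (sum-+ (λ j → 𝟙 (i ≟ a) * line j p q) (λ j → 𝟙 (i ≟ b) * line j r u))
            (cong₂ _+_ (trans (sum-*ˡ (𝟙 (i ≟ a)) (λ j → line j p q)) (cong (𝟙 (i ≟ a) *_) (line-sum p q)))
                       (trans (sum-*ˡ (𝟙 (i ≟ b)) (λ j → line j r u)) (cong (𝟙 (i ≟ b) *_) (line-sum r u))))

    colSum-corners : ∀ p q r u j →
                     colSum (corners p q r u) j ≡ 𝟙 (j ≟ c) * (p + r) + 𝟙 (j ≟ d) * (q + u)
    colSum-corners p q r u j =
      trans (sum-+ (λ i → 𝟙 (i ≟ a) * line j p q) (λ i → 𝟙 (i ≟ b) * line j r u))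
            (trans (cong₂ _+_ (sum-𝟙 a (line j p q)) (sum-𝟙 b (line j r u)))
                   (regroup (𝟙 (j ≟ c)) (𝟙 (j ≟ d)) p q r u))
      where
      regroup : ∀ γ κ p q r u → (γ * p + κ * q) + (γ * r + κ * u) ≡ γ * (p + r) + κ * (q + u)
      regroup = solve-∀

    total-corners : ∀ p q r u → total (corners p q r u) ≡ (p + q) + (r + u)
    total-corners p q r u =
      trans (sum-cong (rowSum-corners p q r u))
            (trans (sum-+ (λ i → 𝟙 (i ≟ a) * (p + q)) (λ i → 𝟙 (i ≟ b) * (r + u))) (cong₂ _+_ (sum-𝟙 a (p + q)) (sum-𝟙 b (r + u))))

    even-corners : ∀ {M : Mat m k} {p q r u} →
                   Even (p + q) → Even (r + u) → Even (p + r) → Even (q + u) →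
                   EvenLines M → EvenLines (M ⊕ corners p q r u)
    even-corners {M} {p} {q} {r} {u} pq ru pr qu (rows , cols) =
      (λ i → subst Even (sym (trans (rowSum-⊕ M (corners p q r u) i) (cong (_+_ (rowSum M i)) (rowSum-corners p q r u i))))
                   (even-+ (rows i) (even-+ (even-*ˡ (𝟙 (i ≟ a)) pq) (even-*ˡ (𝟙 (i ≟ b)) ru)))) ,
      (λ j → subst Even (sym (trans (colSum-⊕ M (corners p q r u) j) (cong (_+_ (colSum M j)) (colSum-corners p q r u j))))
                   (even-+ (cols j) (even-+ (even-*ˡ (𝟙 (j ≟ c)) pr) (even-*ˡ (𝟙 (j ≟ d)) qu))))

    balanced-corners : ∀ {M : Mat m k} {p q r u} →
                       p + q ≡ 0ℤ → r + u ≡ 0ℤ → p + r ≡ 0ℤ → q + u ≡ 0ℤ →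
                       (∀ i → rowSum M i ≡ 0ℤ) → (∀ j → colSum M j ≡ 0ℤ) →
                       (∀ i → rowSum (M ⊕ corners p q r u) i ≡ 0ℤ) ×
                       (∀ j → colSum (M ⊕ corners p q r u) j ≡ 0ℤ)
    balanced-corners {M} {p} {q} {r} {u} pq ru pr qu rows cols =
      (λ i → trans (rowSum-⊕ M (corners p q r u) i)
                   (trans (cong₂ _+_ (rows i) (rowSum-corners p q r u i))
                          (trans (cong₂ (λ x y → 0ℤ + (𝟙 (i ≟ a) * x + 𝟙 (i ≟ b) * y)) pq ru)
                                 (vanish (𝟙 (i ≟ a)) (𝟙 (i ≟ b)))))) ,
      (λ j → trans (colSum-⊕ M (corners p q r u) j)
                   (trans (cong₂ _+_ (cols j) (colSum-corners p q r u j))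
                          (trans (cong₂ (λ x y → 0ℤ + (𝟙 (j ≟ c) * x + 𝟙 (j ≟ d) * y)) pr qu)
                                 (vanish (𝟙 (j ≟ c)) (𝟙 (j ≟ d))))))
      where
      vanish : ∀ x y → 0ℤ + (x * 0ℤ + y * 0ℤ) ≡ 0ℤ
      vanish = solve-∀

    data Position : Fin m → Fin k → Set where
      at-ac : Position a c
      at-ad : Position a d
      at-bc : Position b c
      at-bd : Position b d
      outside : ∀ {i j} → (i ≢ a × i ≢ b) ⊎ (j ≢ c × j ≢ d) → Position i j

    position : ∀ i j → Position i j
    position i j with i ≟ a | i ≟ b | j ≟ c | j ≟ d
    ... | yes refl | _        | yes refl | _        = at-ac
    ... | yes refl | _        | no _     | yes refl = at-ad
    ... | yes refl | _        | no j≢c   | no j≢d   = outside (inj₂ (j≢c , j≢d))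
    ... | no _     | yes refl | yes refl | _        = at-bc
    ... | no _     | yes refl | no _     | yes refl = at-bd
    ... | no _     | yes refl | no j≢c   | no j≢d   = outside (inj₂ (j≢c , j≢d))
    ... | no i≢a   | no i≢b   | _        | _        = outside (inj₁ (i≢a , i≢b))

    corners-at : ∀ {p q r u α β γ κ} i j →
                 𝟙 (i ≟ a) ≡ α → 𝟙 (i ≟ b) ≡ β → 𝟙 (j ≟ c) ≡ γ → 𝟙 (j ≟ d) ≡ κ →
                 corners p q r u i j ≡ α * (γ * p + κ * q) + β * (γ * r + κ * u)
    corners-at i j refl refl refl refl = refl

    module Entries (a≢b : a ≢ b) (c≢d : c ≢ d) where

      corners-ac : ∀ {p q r u} → corners p q r u a c ≡ p
      corners-ac {p} {q} {r} {u} =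
        trans (corners-at a c (𝟙-yes (a ≟ a) refl) (𝟙-no (a ≟ b) a≢b) (𝟙-yes (c ≟ c) refl) (𝟙-no (c ≟ d) c≢d))
              (select p q r u)
        where
        select : ∀ p q r u → 1ℤ * (1ℤ * p + 0ℤ * q) + 0ℤ * (1ℤ * r + 0ℤ * u) ≡ p
        select = solve-∀

      corners-ad : ∀ {p q r u} → corners p q r u a d ≡ q
      corners-ad {p} {q} {r} {u} =
        trans (corners-at a d (𝟙-yes (a ≟ a) refl) (𝟙-no (a ≟ b) a≢b) (𝟙-no (d ≟ c) (≢-sym c≢d)) (𝟙-yes (d ≟ d) refl))
              (select p q r u)
        where
        select : ∀ p q r u → 1ℤ * (0ℤ * p + 1ℤ * q) + 0ℤ * (0ℤ * r + 1ℤ * u) ≡ q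
        select = solve-∀

      corners-bc : ∀ {p q r u} → corners p q r u b c ≡ r
      corners-bc {p} {q} {r} {u} =
        trans (corners-at b c (𝟙-no (b ≟ a) (≢-sym a≢b)) (𝟙-yes (b ≟ b) refl) (𝟙-yes (c ≟ c) refl) (𝟙-no (c ≟ d) c≢d))
              (select p q r u)
        where
        select : ∀ p q r u → 0ℤ * (1ℤ * p + 0ℤ * q) + 1ℤ * (1ℤ * r + 0ℤ * u) ≡ r
        select = solve-∀

      corners-bd : ∀ {p q r u} → corners p q r u b d ≡ u
      corners-bd {p} {q} {r} {u} =
        trans (corners-at b d (𝟙-no (b ≟ a) (≢-sym a≢b)) (𝟙-yes (b ≟ b) refl) (𝟙-no (d ≟ c) (≢-sym c≢d)) (𝟙-yes (d ≟ d) refl))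
              (select p q r u)
        where
        select : ∀ p q r u → 0ℤ * (0ℤ * p + 1ℤ * q) + 1ℤ * (0ℤ * r + 1ℤ * u) ≡ u
        select = solve-∀

      corners-outside : ∀ {p q r u i j} → (i ≢ a × i ≢ b) ⊎ (j ≢ c × j ≢ d) → corners p q r u i j ≡ 0ℤ
      corners-outside {p} {q} {r} {u} {i} {j} (inj₁ (i≢a , i≢b)) =
        corners-at {p} {q} {r} {u} i j (𝟙-no (i ≟ a) i≢a) (𝟙-no (i ≟ b) i≢b) refl refl
      corners-outside {p} {q} {r} {u} {i} {j} (inj₂ (j≢c , j≢d)) =
        trans (corners-at {p} {q} {r} {u} i j refl refl (𝟙-no (j ≟ c) j≢c) (𝟙-no (j ≟ d) j≢d))
              (cong₂ _+_ (ℤₚ.*-zeroʳ (𝟙 (i ≟ a))) (ℤₚ.*-zeroʳ (𝟙 (i ≟ b))))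

  -- Toggling a bit: x + (1 - x - x) = 1 - x.
  toggle-bit : ∀ {x} → Bit x → Bit (x + (1ℤ - x - x))
  toggle-bit (inj₁ refl) = inj₂ refl
  toggle-bit (inj₂ refl) = inj₁ refl

  untoggle-square : ∀ {e} x → Bit e → x ² ≡ e + (1ℤ - e - e) → (x + - unit-sign x) ² ≡ e
  untoggle-square x (inj₁ refl) x²≡1 with square-one x x²≡1
  ... | inj₁ refl = refl
  ... | inj₂ refl = refl
  untoggle-square x (inj₂ refl) x²≡0 with square-zero x x²≡0
  ... | refl = refl

  -- The three cleared ones and the toggled entry remove 2 or 4 from the total.
  shortcut-weight : ∀ {e} → Bit e → (-1ℤ + (1ℤ - e - e)) + (-1ℤ + -1ℤ) < 0ℤ
  shortcut-weight (inj₁ refl) = -<+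
  shortcut-weight (inj₂ refl) = -<+

  module Shortcut {E : Mat m k} (bits : Binary E) {r₀ r₁ : Fin m} {c d : Fin k}
                  (r₀≢r₁ : r₀ ≢ r₁) (c≢d : c ≢ d)
                  (E₀c : E r₀ c ≡ 1ℤ) (E₁c : E r₁ c ≡ 1ℤ) (E₁d : E r₁ d ≡ 1ℤ) where
    open Corners r₀ r₁ c d
    open Entries r₀≢r₁ c≢d

    e : ℤ
    e = E r₀ d

    toggle : ℤ
    toggle = 1ℤ - e - e

    E′ : Mat m k
    E′ = E ⊕ corners -1ℤ toggle -1ℤ -1ℤ

    E′-ac : E′ r₀ c ≡ 0ℤ
    E′-ac = cong₂ _+_ E₀c corners-ac

    E′-ad : E′ r₀ d ≡ e + toggle
    E′-ad = cong (_+_ e) corners-ad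

    E′-bc : E′ r₁ c ≡ 0ℤ
    E′-bc = cong₂ _+_ E₁c corners-bc

    E′-bd : E′ r₁ d ≡ 0ℤ
    E′-bd = cong₂ _+_ E₁d corners-bd

    E′-outside : ∀ {i j} → (i ≢ r₀ × i ≢ r₁) ⊎ (j ≢ c × j ≢ d) → E′ i j ≡ E i j
    E′-outside {i} {j} out = trans (cong (_+_ (E i j)) (corners-outside out)) (ℤₚ.+-identityʳ (E i j))

    E′-binary : Binary E′
    E′-binary i j with position i j
    ... | at-ac     = inj₁ E′-ac
    ... | at-ad     = subst Bit (sym E′-ad) (toggle-bit (bits r₀ d))
    ... | at-bc     = inj₁ E′-bc
    ... | at-bd     = inj₁ E′-bd
    ... | outside o = subst Bit (sym (E′-outside o)) (bits i j)

    E′-even : EvenLines E → EvenLines E′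
    E′-even = even-corners (- e , half-toggle₁ e) (-1ℤ , refl) (-1ℤ , refl) (- e , half-toggle₂ e)
      where
      half-toggle₁ : ∀ e → -1ℤ + (1ℤ - e - e) ≡ - e + - e
      half-toggle₁ = solve-∀
      half-toggle₂ : ∀ e → (1ℤ - e - e) + -1ℤ ≡ - e + - e
      half-toggle₂ = solve-∀

    E′-smaller : total E′ < total E
    E′-smaller =
      subst (_< total E)
            (sym (trans (total-⊕ E _) (cong (_+_ (total E)) (total-corners -1ℤ toggle -1ℤ -1ℤ))))
            (subst (total E + _ <_) (ℤₚ.+-identityʳ (total E))
                   (ℤₚ.+-monoʳ-< (total E) (shortcut-weight (bits r₀ d))))

    -- A balanced signing T of E′ becomes one of E by adding the corners (s, -s, -s, s),
    -- where s = unit-sign (T r₀ d) makes the entry at (r₀,d) square to e again.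
    lift : BalancedSigning E′ → BalancedSigning E
    lift T = record
      { sign    = S
      ; squares = S-squares
      ; rows    = proj₁ S-balanced
      ; cols    = proj₂ S-balanced
      }
      where
      open BalancedSigning T renaming (sign to T′; squares to T′-squares; rows to T′-rows; cols to T′-cols)

      s : ℤ
      s = unit-sign (T′ r₀ d)

      S : Mat m k
      S = T′ ⊕ corners s (- s) (- s) s

      S-balanced : (∀ i → rowSum S i ≡ 0ℤ) × (∀ j → colSum S j ≡ 0ℤ)
      S-balanced = balanced-corners (ℤₚ.+-inverseʳ s) (ℤₚ.+-inverseˡ s) (ℤₚ.+-inverseʳ s) (ℤₚ.+-inverseˡ s)
                                    T′-rows T′-cols

      restored : ∀ {i j y} → corners s (- s) (- s) s i j ≡ y → E′ i j ≡ 0ℤ → y ² ≡ 1ℤ → E i j ≡ 1ℤ →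
                 S i j ² ≡ E i j
      restored {i} {j} {y} at-y E′≡0 y²≡1 E≡1 =
        trans (cong _² (trans (cong₂ _+_ (square-zero (T′ i j) (trans (T′-squares i j) E′≡0)) at-y)
                              (ℤₚ.+-identityˡ y)))
              (trans y²≡1 (sym E≡1))

      S-squares : ∀ i j → S i j ² ≡ E i j
      S-squares i j with position i j
      ... | at-ac = restored corners-ac E′-ac (unit-sign² (T′ r₀ d)) E₀c
      ... | at-ad = trans (cong (λ z → (T′ r₀ d + z) ²) corners-ad)
                          (untoggle-square (T′ r₀ d) (bits r₀ d) (trans (T′-squares r₀ d) E′-ad))
      ... | at-bc = restored corners-bc E′-bc (neg-unit-sign² (T′ r₀ d)) E₁c
      ... | at-bd = restored corners-bd E′-bd (unit-sign² (T′ r₀ d)) E₁d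
      ... | outside o =
        trans (cong (λ z → (T′ i j + z) ²) (corners-outside o))
              (trans (cong _² (ℤₚ.+-identityʳ (T′ i j))) (trans (T′-squares i j) (E′-outside o)))

  nonneg-below : ∀ {x t} → 0ℤ ≤ x → x < + t → ∃ λ t′ → t′ ℕ.< t × x ≡ + t′
  nonneg-below {x} 0≤x x<t =
    ℤ.∣ x ∣ , ℤₚ.drop‿+<+ (subst (_< _) (sym |x|≡x) x<t) , sym |x|≡x
    where
    |x|≡x : + ℤ.∣ x ∣ ≡ x
    |x|≡x = ℤₚ.0≤i⇒+∣i∣≡i 0≤x

  balanced-signing : (E : Mat m k) → Binary E → EvenLines E → BalancedSigning E
  balanced-signing {m} {k} E bits even =
    <-rec P step ℤ.∣ total E ∣ E bits even (sym (ℤₚ.0≤i⇒+∣i∣≡i (total-nonneg bits)))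
    where
    P : ℕ → Set
    P t = (F : Mat m k) → Binary F → EvenLines F → total F ≡ + t → BalancedSigning F

    step : ∀ t → (∀ {t′} → t′ ℕ.< t → P t′) → P t
    step t smaller E bits even total≡t with find-one E bits
    ... | inj₁ zeros = zero-signing zeros
    ... | inj₂ (r₀ , c , E₀c) =
      let (r₁ , r₁≢r₀ , E₁c) = another-one (λ i → E i c) (λ i → bits i c) (proj₂ even c) E₀c
          (d , d≢c , E₁d)   = another-one (E r₁) (bits r₁) (proj₁ even r₁) E₁c
          open Shortcut bits (≢-sym r₁≢r₀) (≢-sym d≢c) E₀c E₁c E₁d
          (t′ , t′<t , total≡t′) =
            nonneg-below (total-nonneg E′-binary) (subst (total E′ <_) total≡t E′-smaller)
      in lift (smaller t′<t E′ E′-binary (E′-even even) total≡t′)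

module ZeroEntries where
  open BalancedSignings
  import Data.Nat as ℕ
  open import Data.Integer using (ℤ; +_; _+_; _-_; _*_; 0ℤ; 1ℤ; -1ℤ; _≟_)
  import Data.Integer.Properties as ℤₚ
  open import Data.Integer.Tactic.RingSolver using (solve-∀)
  open import Data.Fin using (Fin)
  open import Data.Product using (_×_; _,_; proj₁; proj₂)
  open import Data.Sum using (inj₁; inj₂)
  open import Data.Empty using (⊥-elim)
  open import Relation.Binary.PropositionalEquality
  open ≡-Reasoning

  zero-pattern : ∀ {n} → Matrix n → Mat n n
  zero-pattern A i j = 𝟙 (A i j ≟ 0ℤ)

  zero-pattern-binary : ∀ {n} (A : Matrix n) → Binary (zero-pattern A)
  zero-pattern-binary A i j = 𝟙-bit (A i j ≟ 0ℤ)

  count-entry : ∀ x → IsZeroPM1 x → 𝟙 (x ≟ 0ℤ) + x + + 2 * 𝟙 (x ≟ -1ℤ) ≡ 1ℤ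
  count-entry _ (inj₁ (inj₁ refl)) = refl
  count-entry _ (inj₁ (inj₂ refl)) = refl
  count-entry _ (inj₂ refl)        = refl

  even-zeros : ∀ k (f : Fin (1 ℕ.+ 2 ℕ.* k) → ℤ) → (∀ j → IsZeroPM1 (f j)) → sumℤ f ≡ 1ℤ →
               Even (sumℤ (λ j → 𝟙 (f j ≟ 0ℤ)))
  even-zeros k f entries sum≡1 = + k - N , cancel Z N (+ k) counted
    where
    Z N : ℤ
    Z = sumℤ (λ j → 𝟙 (f j ≟ 0ℤ))
    N = sumℤ (λ j → 𝟙 (f j ≟ -1ℤ))

    counted : Z + 1ℤ + + 2 * N ≡ 1ℤ + + 2 * + k
    counted = begin
      Z + 1ℤ + + 2 * N
        ≡⟨ cong (λ t → Z + t + + 2 * N) (sym sum≡1) ⟩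
      Z + sumℤ f + + 2 * N
        ≡⟨ sym (trans (sum-+ (λ j → 𝟙 (f j ≟ 0ℤ) + f j) (λ j → + 2 * 𝟙 (f j ≟ -1ℤ)))
                      (cong₂ _+_ (sum-+ (λ j → 𝟙 (f j ≟ 0ℤ)) f) (sum-*ˡ (+ 2) (λ j → 𝟙 (f j ≟ -1ℤ))))) ⟩
      sumℤ (λ j → 𝟙 (f j ≟ 0ℤ) + f j + + 2 * 𝟙 (f j ≟ -1ℤ))
        ≡⟨ sum-cong (λ j → count-entry (f j) (entries j)) ⟩
      sumℤ {1 ℕ.+ 2 ℕ.* k} (λ _ → 1ℤ)
        ≡⟨ sum-ones ⟩
      + (1 ℕ.+ 2 ℕ.* k)
        ≡⟨ cong (_+_ 1ℤ) (ℤₚ.pos-* 2 k) ⟩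
      1ℤ + + 2 * + k ∎

    cancel : ∀ Z N K → Z + 1ℤ + + 2 * N ≡ 1ℤ + + 2 * K → Z ≡ (K - N) + (K - N)
    cancel Z N K eq = begin
      Z                                     ≡⟨ isolate Z N ⟩
      (Z + 1ℤ + + 2 * N) - 1ℤ - + 2 * N     ≡⟨ cong (λ t → t - 1ℤ - + 2 * N) eq ⟩
      (1ℤ + + 2 * K) - 1ℤ - + 2 * N         ≡⟨ halve K N ⟩
      (K - N) + (K - N)                     ∎
      where
      isolate : ∀ Z N → Z ≡ (Z + 1ℤ + + 2 * N) - 1ℤ - + 2 * N
      isolate = solve-∀
      halve : ∀ K N → (1ℤ + + 2 * K) - 1ℤ - + 2 * N ≡ (K - N) + (K - N)
      halve = solve-∀

  zero-pattern-even : ∀ {n} k → n ≡ 1 ℕ.+ 2 ℕ.* k → {A : Matrix n} → SemiASM A →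
                      EvenLines (zero-pattern A)
  zero-pattern-even k refl {A} asm =
    (λ i → even-zeros k (A i) (entries i) (SemiASM.rowSum asm i)) ,
    (λ j → even-zeros k (λ i → A i j) (λ i → entries i j) (SemiASM.colSum asm j))
    where
    open SemiASM asm using (entries)

  fill-entry : ∀ x y → IsZeroPM1 x → y ² ≡ 𝟙 (x ≟ 0ℤ) →
               IsZeroPM1 (x + y) × x + y ≢ 0ℤ × (x ≢ 0ℤ → x + y ≡ x)
  fill-entry _ y (inj₁ (inj₁ refl)) y²≡1 with square-one y y²≡1
  ... | inj₁ refl = inj₁ (inj₂ refl) , (λ ()) , (λ 0≢0 → ⊥-elim (0≢0 refl))
  ... | inj₂ refl = inj₂ refl , (λ ()) , (λ 0≢0 → ⊥-elim (0≢0 refl))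
  fill-entry _ y (inj₁ (inj₂ refl)) y²≡0 with square-zero y y²≡0
  ... | refl = inj₁ (inj₂ refl) , (λ ()) , (λ _ → refl)
  fill-entry _ y (inj₂ refl) y²≡0 with square-zero y y²≡0
  ... | refl = inj₂ refl , (λ ()) , (λ _ → refl)

  module Filling {n} {A : Matrix n} (asm : SemiASM A) (S : BalancedSigning (zero-pattern A)) where
    open BalancedSigning S

    B : Matrix n
    B = A ⊕ sign

    filled : ∀ i j → IsZeroPM1 (B i j) × B i j ≢ 0ℤ × (A i j ≢ 0ℤ → B i j ≡ A i j)
    filled i j = fill-entry (A i j) (sign i j) (SemiASM.entries asm i j) (squares i j)

    extension : SemiASMExtension A B
    extension = record
      { semiASM-A = asm
      ; semiASM-B = record
        { entries = λ i j → proj₁ (filled i j)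
        ; rowSum  = λ i → trans (rowSum-⊕ A sign i) (cong₂ _+_ (SemiASM.rowSum asm i) (rows i))
        ; colSum  = λ j → trans (colSum-⊕ A sign j) (cong₂ _+_ (SemiASM.colSum asm j) (cols j))
        }
      ; agrees    = λ i j → proj₂ (proj₂ (filled i j))
      }

    nonzero : ∀ i j → B i j ≢ 0ℤ
    nonzero i j = proj₁ (proj₂ (filled i j))

open import Data.Nat using (ℕ; _+_; _*_)
open import Data.Integer using (0ℤ)
open import Data.Product using (Σ; _×_; _,_)
open import Relation.Binary.PropositionalEquality using (_≡_; _≢_)

theorem4p8 : (n : ℕ) → (Σ ℕ λ k → n ≡ 1 + 2 * k) →
    (A : Matrix n) → SemiASM A →
    Σ (Matrix n) λ B → SemiASMExtension A B × (∀ i j → B i j ≢ 0ℤ)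
theorem4p8 n (k , odd) A asm = B , extension , nonzero
  where
  open BalancedSignings using (balanced-signing)
  open ZeroEntries
  open Filling asm (balanced-signing (zero-pattern A) (zero-pattern-binary A) (zero-pattern-even k odd asm))
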